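{- Let $\alpha\neq 0$ and $R$ be integers, let $h\ge 1$ and $n\ge 0$ be integers, and let $N$ be any integer dividing $\alpha^h\,h!\,p_h(\alpha,R)$. Then \[ p_n(\alpha,R)\equiv [z^n]\,\mathrm{Conv}_h(\alpha,R;z)\pmod{N}. \] In particular, for $h\ge 2$, $p_n(\alpha,R)\equiv [z^n]\mathrm{Conv}_h(\alpha,R;z)$ modulo $h$ and modulo $h\alpha^i$ for each $1\le i\le h$.
   Context: For $n\ge0$, $p_n(\alpha,R)=\prod_{j=0}^{n-1}(R+\alpha j)$ with $p_0=1$. The polynomials $P_h,Q_h$ are defined by: $P_h(\alpha,R;z)=(1-(R+2\alpha(h-1))z)P_{h-1}(\alpha,R;z)-\alpha(R+\alpha(h-2))(h-1)z^2P_{h-2}(\alpha,R;z)$ for $h\ge2$, $P_1=1$, $P_h=0$ for $h\le0$; $Q_h$ satisfies the same recurrence for $h\ge2$ with $Q_1=1-Rz$, $Q_0=1$, $Q_h=0$ for $h<0$. Then $\mathrm{Conv}_h(\alpha,R;z)=P_h/Q_h$, expanded as a formal power series in $z$ (it has integer coefficients since $Q_h$ has integer coefficients and constant term $1$). $[z^n]F$ denotes the coefficient of $z^n$ in $F$. -}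

module Defs where

open import Data.Nat as ℕ using (ℕ; zero; suc)
open import Data.Integer using (ℤ; +_; _+_; _-_; _*_; -_; 0ℤ; 1ℤ)
open import Data.List using (List; []; _∷_; zipWith; drop; foldr)

sumℤ : List ℤ → ℤ
sumℤ = foldr _+_ 0ℤ

-- Polynomials in z with integer coefficients: coefficient lists, lowest degree first.
Poly : Set
Poly = List ℤ

_⊕_ : Poly → Poly → Poly
[] ⊕ q = q
(a ∷ p) ⊕ [] = a ∷ p
(a ∷ p) ⊕ (b ∷ q) = (a + b) ∷ (p ⊕ q)

scale : ℤ → Poly → Poly
scale c [] = []
scale c (a ∷ p) = (c * a) ∷ scale c p

shiftZ : Poly → Poly
shiftZ p = 0ℤ ∷ p

coeff : Poly → ℕ → ℤ
coeff [] n = 0ℤ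
coeff (a ∷ p) zero = a
coeff (a ∷ p) (suc n) = coeff p n

pPoch : ℤ → ℤ → ℕ → ℤ
pPoch α R zero = 1ℤ
pPoch α R (suc n) = pPoch α R n * (R + α * + n)

-- The three-term recurrence, valid for h = k + 2 ≥ 2:
-- X_h = (1 - (R + 2α(h-1)) z) X_{h-1} - α (R + α(h-2)) (h-1) z² X_{h-2}
recStep : ℤ → ℤ → ℕ → Poly → Poly → Poly
recStep α R k x1 x0 =
  (x1 ⊕ scale (- (R + + 2 * α * + (suc k))) (shiftZ x1))
  ⊕ scale (- (α * (R + α * + k) * + (suc k))) (shiftZ (shiftZ x0))

recSeq : ℤ → ℤ → Poly → Poly → ℕ → Poly
recSeq α R x0 x1 zero = x0
recSeq α R x0 x1 (suc zero) = x1
recSeq α R x0 x1 (suc (suc k)) =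
  recStep α R k (recSeq α R x0 x1 (suc k)) (recSeq α R x0 x1 k)

P : ℤ → ℤ → ℕ → Poly
P α R = recSeq α R [] (1ℤ ∷ [])

Q : ℤ → ℤ → ℕ → Poly
Q α R = recSeq α R (1ℤ ∷ []) (1ℤ ∷ (- R) ∷ [])

-- Formal power series quotient F = A / B, for B with constant term 1:
-- the unique F with B·F = A, i.e. F_n = A_n - Σ_{k=1}^{n} B_k F_{n-k}.
-- divRev A B n = [F_{n-1}, F_{n-2}, …, F_0].
divRev : Poly → Poly → ℕ → List ℤ
divRev A B zero = []
divRev A B (suc n) =
  (coeff A n - sumℤ (zipWith _*_ (drop 1 B) (divRev A B n))) ∷ divRev A B n

seriesDivCoeff : Poly → Poly → ℕ → ℤ
seriesDivCoeff A B n with divRev A B (suc n)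
... | f ∷ _ = f
... | [] = 0ℤ

convCoeff : ℤ → ℤ → ℕ → ℕ → ℤ
convCoeff α R h n = seriesDivCoeff (P α R h) (Q α R h) n

module Submission where

open import Defs
open import Data.Nat using (ℕ; _≤_; _!)
open import Data.Integer using (ℤ; +_; _-_; _*_; _^_)
open import Data.Integer.Divisibility using (_∣_)
open import Data.Product using (_×_)
open import Relation.Binary.PropositionalEquality using (_≢_)

open import Data.Nat as ℕ using (zero; suc; _<_; _≤′_; ≤′-refl; ≤′-step; s≤s; z≤n)
import Data.Nat.Properties as ℕP
import Data.Nat.Divisibility as ℕD
open import Data.Nat.Induction using (<-rec)
open import Data.Integer using (0ℤ; 1ℤ; -_; _+_)
import Data.Integer.Properties as ℤP
open import Data.Integer.Divisibility.Signed
  using (divides; ∣-refl; ∣-trans; ∣ᵤ⇒∣; ∣⇒∣ᵤ; ∣m∣n⇒∣m+n; ∣m∣n⇒∣m-n; ∣m⇒∣m*n; ∣n⇒∣m*n;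
         *-monoʳ-∣; *-monoˡ-∣)
  renaming (_∣_ to _∣ₛ_)
open import Data.Integer.Tactic.RingSolver using (solve-∀)
open import Data.List using ([]; _∷_; zipWith)
open import Data.List.Properties using (zipWith-zeroʳ)
open import Data.Product using (Σ; _,_)
open import Data.Sum using (inj₁; inj₂)
open import Relation.Binary.PropositionalEquality
  using (_≡_; refl; sym; trans; cong; cong₂; subst; module ≡-Reasoning)

open ≡-Reasoning

-- With p(z) = Σ p_n zⁿ, the series p − P_h/Q_h is ≡ 0 (mod N) coefficientwise as soon as
-- Q_h·p − P_h is, because Q_h has constant term 1. The three-term recurrence shared by P_h and Q_h
-- gives the closed form Q_h·p − P_h = α^h Σ_m m(m−1)⋯(m−h+1) p_m z^(h+m), and each of its
-- coefficients is divisible by α^h h! p_h: h! divides the falling factorial, which vanishes unless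
-- m ≥ h, and then p_h ∣ p_m.

≡0⇒∣ : ∀ {N x} → x ≡ 0ℤ → N ∣ₛ x
≡0⇒∣ refl = divides 0ℤ refl

*-mono-∣ : ∀ {x y u v} → x ∣ₛ y → u ∣ₛ v → x * u ∣ₛ y * v
*-mono-∣ {y = y} {u} x∣y u∣v = ∣-trans (*-monoˡ-∣ u x∣y) (*-monoʳ-∣ y u∣v)

∣-mono-≤ : ∀ (f : ℕ → ℤ) → (∀ n → f n ∣ₛ f (suc n)) → ∀ {m n} → m ≤ n → f m ∣ₛ f n
∣-mono-≤ f step m≤n = go (ℕP.≤⇒≤′ m≤n)
  where
  go : ∀ {m n} → m ≤′ n → f m ∣ₛ f n
  go ≤′-refl        = ∣-refl
  go (≤′-step m≤′n) = ∣-trans (go m≤′n) (step _)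

-- [zⁿ] of A(z) · Σⱼ s j zʲ
coeffMul : Poly → (ℕ → ℤ) → ℕ → ℤ
coeffMul []      s n       = 0ℤ
coeffMul (a ∷ A) s zero    = a * s zero
coeffMul (a ∷ A) s (suc n) = a * s (suc n) + coeffMul A s n

coeffMul-⊕ : ∀ A B s n → coeffMul (A ⊕ B) s n ≡ coeffMul A s n + coeffMul B s n
coeffMul-⊕ []      B       s n       = sym (ℤP.+-identityˡ _)
coeffMul-⊕ (a ∷ A) []      s n       = sym (ℤP.+-identityʳ _)
coeffMul-⊕ (a ∷ A) (b ∷ B) s zero    = ℤP.*-distribʳ-+ (s zero) a b
coeffMul-⊕ (a ∷ A) (b ∷ B) s (suc n) =
  trans (cong (λ t → (a + b) * s (suc n) + t) (coeffMul-⊕ A B s n))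
        (regroup a b (s (suc n)) (coeffMul A s n) (coeffMul B s n))
  where
  regroup : ∀ a b x u v → (a + b) * x + (u + v) ≡ (a * x + u) + (b * x + v)
  regroup = solve-∀

coeffMul-scale : ∀ c A s n → coeffMul (scale c A) s n ≡ c * coeffMul A s n
coeffMul-scale c []      s n       = sym (ℤP.*-zeroʳ c)
coeffMul-scale c (a ∷ A) s zero    = ℤP.*-assoc c a (s zero)
coeffMul-scale c (a ∷ A) s (suc n) =
  trans (cong₂ _+_ (ℤP.*-assoc c a (s (suc n))) (coeffMul-scale c A s n))
        (sym (ℤP.*-distribˡ-+ c (a * s (suc n)) (coeffMul A s n)))

coeffMul-shiftZ : ∀ A s n → coeffMul (shiftZ A) s (suc n) ≡ coeffMul A s n
coeffMul-shiftZ A s n = ℤP.+-identityˡ _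

coeffMul-sub : ∀ A (s t : ℕ → ℤ) n →
  coeffMul A (λ j → s j - t j) n ≡ coeffMul A s n - coeffMul A t n
coeffMul-sub []      s t n       = refl
coeffMul-sub (a ∷ A) s t zero    = distrib a (s zero) (t zero)
  where
  distrib : ∀ a x y → a * (x - y) ≡ a * x - a * y
  distrib = solve-∀
coeffMul-sub (a ∷ A) s t (suc n) =
  trans (cong (λ u → a * (s (suc n) - t (suc n)) + u) (coeffMul-sub A s t n))
        (regroup a (s (suc n)) (t (suc n)) (coeffMul A s n) (coeffMul A t n))
  where
  regroup : ∀ a x y u v → a * (x - y) + (u - v) ≡ (a * x + u) - (a * y + v)
  regroup = solve-∀

coeffMul-∣ : ∀ {N} A (s : ℕ → ℤ) n → (∀ j → j ≤ n → N ∣ₛ s j) → N ∣ₛ coeffMul A s n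
coeffMul-∣ []      s n       N∣s = ≡0⇒∣ refl
coeffMul-∣ (a ∷ A) s zero    N∣s = ∣n⇒∣m*n a (N∣s zero z≤n)
coeffMul-∣ (a ∷ A) s (suc n) N∣s =
  ∣m∣n⇒∣m+n (∣n⇒∣m*n a (N∣s (suc n) ℕP.≤-refl))
            (coeffMul-∣ A s n (λ j j≤n → N∣s j (ℕP.m≤n⇒m≤1+n j≤n)))

coeff-⊕ : ∀ A B n → coeff (A ⊕ B) n ≡ coeff A n + coeff B n
coeff-⊕ []      B       n       = sym (ℤP.+-identityˡ _)
coeff-⊕ (a ∷ A) []      n       = sym (ℤP.+-identityʳ _)
coeff-⊕ (a ∷ A) (b ∷ B) zero    = refl
coeff-⊕ (a ∷ A) (b ∷ B) (suc n) = coeff-⊕ A B n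

coeff-scale : ∀ c A n → coeff (scale c A) n ≡ c * coeff A n
coeff-scale c []      n       = sym (ℤP.*-zeroʳ c)
coeff-scale c (a ∷ A) zero    = refl
coeff-scale c (a ∷ A) (suc n) = coeff-scale c A n

residual : (ℕ → ℤ) → Poly → Poly → ℕ → ℤ
residual s X Y n = coeffMul X s n - coeff Y n

residual-shiftZ : ∀ s X Y n → residual s (shiftZ X) (shiftZ Y) (suc n) ≡ residual s X Y n
residual-shiftZ s X Y n = cong (_- coeff Y n) (coeffMul-shiftZ X s n)

_VanishesBelow_ : (ℕ → ℤ) → ℕ → Set
f VanishesBelow h = ∀ n → n < h → f n ≡ 0ℤ

vanishesBelow-suc : ∀ {f h} → f VanishesBelow h → f h ≡ 0ℤ → f VanishesBelow suc h
vanishesBelow-suc below at n (s≤s n≤h) with ℕP.m≤n⇒m<n∨m≡n n≤h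
... | inj₁ n<h  = below n n<h
... | inj₂ refl = at

residual-shiftZ-vanishesBelow : ∀ {s X Y h} → residual s X Y VanishesBelow h →
  residual s (shiftZ X) (shiftZ Y) VanishesBelow suc h
residual-shiftZ-vanishesBelow below zero    _ = refl
residual-shiftZ-vanishesBelow {s} {X} {Y} below (suc n) (s≤s n<h) =
  trans (residual-shiftZ s X Y n) (below n n<h)

fallingFactorial : ℤ → ℕ → ℤ
fallingFactorial x zero    = 1ℤ
fallingFactorial x (suc k) = fallingFactorial x k * (x - + k)

fallingFactorial-suc : ∀ x k →
  fallingFactorial (1ℤ + x) (suc k) ≡ (1ℤ + x) * fallingFactorial x k
fallingFactorial-suc x zero    = shape x
  where
  shape : ∀ x → 1ℤ * ((1ℤ + x) - 0ℤ) ≡ (1ℤ + x) * 1ℤ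
  shape = solve-∀
fallingFactorial-suc x (suc k) =
  trans (cong (_* ((1ℤ + x) - (1ℤ + + k))) (fallingFactorial-suc x k))
        (shape x (+ k) (fallingFactorial x k))
  where
  shape : ∀ x k F → ((1ℤ + x) * F) * ((1ℤ + x) - (1ℤ + k)) ≡ (1ℤ + x) * (F * (x - k))
  shape = solve-∀

fallingFactorial-pascal : ∀ x k →
  fallingFactorial (1ℤ + x) (suc k) ≡ fallingFactorial x (suc k) + (1ℤ + + k) * fallingFactorial x k
fallingFactorial-pascal x k =
  trans (fallingFactorial-suc x k) (shape x (+ k) (fallingFactorial x k))
  where
  shape : ∀ x k F → (1ℤ + x) * F ≡ F * (x - k) + (1ℤ + k) * F
  shape = solve-∀

fallingFactorial-vanishes : ∀ m h → m < h → fallingFactorial (+ m) h ≡ 0ℤ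
fallingFactorial-vanishes m (suc h) (s≤s m≤h) with ℕP.m≤n⇒m<n∨m≡n m≤h
... | inj₁ m<h  = cong (_* (+ m - + h)) (fallingFactorial-vanishes m h m<h)
... | inj₂ refl =
  trans (cong (fallingFactorial (+ m) m *_) (ℤP.+-inverseʳ (+ m)))
        (ℤP.*-zeroʳ (fallingFactorial (+ m) m))

!∣fallingFactorial : ∀ m h → + (h !) ∣ₛ fallingFactorial (+ m) h
!∣fallingFactorial m       zero    = ∣-refl
!∣fallingFactorial zero    (suc h) =
  ≡0⇒∣ (fallingFactorial-vanishes 0 (suc h) (s≤s z≤n))
!∣fallingFactorial (suc m) (suc h) =
  subst (_ ∣ₛ_) (sym (fallingFactorial-pascal (+ m) h))
    (∣m∣n⇒∣m+n (!∣fallingFactorial m (suc h))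
      (subst (_∣ₛ (+ suc h * fallingFactorial (+ m) h)) (sym (ℤP.pos-* (suc h) (h !)))
        (*-monoʳ-∣ (+ suc h) (!∣fallingFactorial m h))))

seriesDivCoeff-zipWith : ∀ X B C n →
  sumℤ (zipWith _*_ C (divRev X B (suc n))) ≡ coeffMul C (seriesDivCoeff X B) n
seriesDivCoeff-zipWith X B []      n       = refl
seriesDivCoeff-zipWith X B (c ∷ C) zero    =
  trans (cong (λ t → c * seriesDivCoeff X B 0 + sumℤ t) (zipWith-zeroʳ _*_ C))
        (ℤP.+-identityʳ _)
seriesDivCoeff-zipWith X B (c ∷ C) (suc n) =
  cong (λ t → c * seriesDivCoeff X B (suc n) + t) (seriesDivCoeff-zipWith X B C n)

coeffMul-seriesDivCoeff : ∀ X C n →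
  coeffMul (1ℤ ∷ C) (seriesDivCoeff X (1ℤ ∷ C)) n ≡ coeff X n
coeffMul-seriesDivCoeff X C zero =
  trans (ℤP.*-identityˡ _)
        (trans (cong (λ t → coeff X 0 - sumℤ t) (zipWith-zeroʳ _*_ C)) (ℤP.+-identityʳ _))
coeffMul-seriesDivCoeff X C (suc n) =
  trans (cong (λ t → 1ℤ * (coeff X (suc n) - t) + coeffMul C f n)
              (seriesDivCoeff-zipWith X (1ℤ ∷ C) C n))
        (cancel (coeff X (suc n)) (coeffMul C f n))
  where
  f = seriesDivCoeff X (1ℤ ∷ C)
  cancel : ∀ x y → 1ℤ * (x - y) + y ≡ x
  cancel = solve-∀

∣-coeffMul-cancel : ∀ {N} C (d : ℕ → ℤ) → (∀ n → N ∣ₛ coeffMul (1ℤ ∷ C) d n) → ∀ n → N ∣ₛ d n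
∣-coeffMul-cancel {N} C d N∣ = <-rec (λ n → N ∣ₛ d n) step
  where
  step : ∀ n → (∀ {j} → j < n → N ∣ₛ d j) → N ∣ₛ d n
  step zero    _   = subst (N ∣ₛ_) (ℤP.*-identityˡ (d 0)) (N∣ 0)
  step (suc n) N∣d =
    subst (N ∣ₛ_) (isolate (d (suc n)) (coeffMul C d n))
      (∣m∣n⇒∣m-n (N∣ (suc n)) (coeffMul-∣ C d n (λ j j≤n → N∣d (s≤s j≤n))))
    where
    isolate : ∀ x y → (1ℤ * x + y) - y ≡ x
    isolate = solve-∀

∣-seriesDivCoeff : ∀ {N} (s : ℕ → ℤ) X {B} C → B ≡ 1ℤ ∷ C →
  (∀ n → N ∣ₛ residual s B X n) → ∀ n → N ∣ₛ s n - seriesDivCoeff X B n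
∣-seriesDivCoeff {N} s X C refl N∣res = ∣-coeffMul-cancel C (λ j → s j - f j) N∣difference
  where
  f = seriesDivCoeff X (1ℤ ∷ C)
  N∣difference : ∀ n → N ∣ₛ coeffMul (1ℤ ∷ C) (λ j → s j - f j) n
  N∣difference n = subst (N ∣ₛ_)
    (sym (trans (coeffMul-sub (1ℤ ∷ C) s f n)
                (cong (λ t → coeffMul (1ℤ ∷ C) s n - t) (coeffMul-seriesDivCoeff X C n))))
    (N∣res n)

module Convergents (α R : ℤ) where

  p : ℕ → ℤ
  p = pPoch α R

  pPoch-∣ : ∀ {m n} → m ≤ n → p m ∣ₛ p n
  pPoch-∣ = ∣-mono-≤ p (λ n → ∣m⇒∣m*n _ ∣-refl)

  b c : ℕ → ℤ
  b k = - (R + + 2 * α * + (suc k))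
  c k = - (α * (R + α * + k) * + (suc k))

  recStep-constantTerm : ∀ k x1 x0 C → x1 ≡ 1ℤ ∷ C → Σ Poly (λ D → recStep α R k x1 x0 ≡ 1ℤ ∷ D)
  recStep-constantTerm k _ x0 C refl = _ , cong₂ _∷_ (one+0+0 (b k) (c k)) refl
    where
    one+0+0 : ∀ u v → 1ℤ + u * 0ℤ + v * 0ℤ ≡ 1ℤ
    one+0+0 = solve-∀

  Q-constantTerm : ∀ h → Σ Poly (λ C → Q α R h ≡ 1ℤ ∷ C)
  Q-constantTerm zero          = _ , refl
  Q-constantTerm (suc zero)    = _ , refl
  Q-constantTerm (suc (suc k)) with Q-constantTerm (suc k)
  ... | C , eq = recStep-constantTerm k (Q α R (suc k)) (Q α R k) C eq

  recStep-linear : ∀ (L : Poly → ℤ) →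
    (∀ A B → L (A ⊕ B) ≡ L A + L B) → (∀ t A → L (scale t A) ≡ t * L A) →
    ∀ k x1 x0 → L (recStep α R k x1 x0) ≡
      L x1 + b k * L (shiftZ x1) + c k * L (shiftZ (shiftZ x0))
  recStep-linear L L-⊕ L-scale k x1 x0 =
    trans (L-⊕ _ _)
          (cong₂ _+_ (trans (L-⊕ _ _) (cong (λ t → L x1 + t) (L-scale _ _))) (L-scale _ _))

  residual-recStep : ∀ k X1 X0 Y1 Y0 n →
    residual p (recStep α R k X1 X0) (recStep α R k Y1 Y0) n ≡
      residual p X1 Y1 n + b k * residual p (shiftZ X1) (shiftZ Y1) n
        + c k * residual p (shiftZ (shiftZ X0)) (shiftZ (shiftZ Y0)) n
  residual-recStep k X1 X0 Y1 Y0 n =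
    trans (cong₂ _-_ (recStep-linear (λ A → coeffMul A p n)
                        (λ A B → coeffMul-⊕ A B p n) (λ t A → coeffMul-scale t A p n) k X1 X0)
                     (recStep-linear (λ A → coeff A n)
                        (λ A B → coeff-⊕ A B n) (λ t A → coeff-scale t A n) k Y1 Y0))
          (regroup (coeffMul X1 p n) (coeffMul (shiftZ X1) p n) (coeffMul (shiftZ (shiftZ X0)) p n)
                   (coeff Y1 n) (coeff (shiftZ Y1) n) (coeff (shiftZ (shiftZ Y0)) n) (b k) (c k))
    where
    regroup : ∀ (x1 x1' x0 y1 y1' y0 u v : ℤ) →
      (x1 + u * x1' + v * x0) - (y1 + u * y1' + v * y0)
        ≡ (x1 - y1) + u * (x1' - y1') + v * (x0 - y0)
    regroup = solve-∀

  residualQP : ℕ → ℕ → ℤ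
  residualQP h = residual p (Q α R h) (P α R h)

  residualQP-above : ∀ h m → residualQP h (h ℕ.+ m) ≡ α ^ h * fallingFactorial (+ m) h * p m
  residualQP-above zero zero = refl
  residualQP-above zero (suc m) = shape (p (suc m))
    where
    shape : ∀ x → (1ℤ * x + 0ℤ) - 0ℤ ≡ 1ℤ * 1ℤ * x
    shape = solve-∀
  residualQP-above (suc zero) m =
    trans (cong (λ t → 1ℤ * p (suc m) + t - 0ℤ) (−R-term m)) (shape α R (+ m) (p m))
    where
    −R-term : ∀ m → coeffMul (- R ∷ []) p m ≡ - R * p m
    −R-term zero    = refl
    −R-term (suc m) = ℤP.+-identityʳ _
    shape : ∀ a r M x → 1ℤ * (x * (r + a * M)) + - r * x - 0ℤ ≡ a * 1ℤ * (1ℤ * (M - 0ℤ)) * x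
    shape = solve-∀
  residualQP-above (suc (suc k)) m = begin
    residualQP (2 ℕ.+ k) (2 ℕ.+ k ℕ.+ m)
      ≡⟨ residual-recStep k Q₁ Q₀ P₁ P₀ (2 ℕ.+ k ℕ.+ m) ⟩
    residualQP (1 ℕ.+ k) (2 ℕ.+ k ℕ.+ m) + b k * residual p (shiftZ Q₁) (shiftZ P₁) (2 ℕ.+ k ℕ.+ m)
      + c k * residual p (shiftZ (shiftZ Q₀)) (shiftZ (shiftZ P₀)) (2 ℕ.+ k ℕ.+ m)
      ≡⟨ cong₂ _+_ (cong₂ (λ x y → x + b k * y)
                     (trans (cong (λ j → residualQP (suc k) (suc j)) (sym (ℕP.+-suc k m)))
                            (residualQP-above (suc k) (suc m)))
                     (trans (residual-shiftZ p Q₁ P₁ (suc (k ℕ.+ m)))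
                            (residualQP-above (suc k) m)))
                   (cong (c k *_) (trans (residual-shiftZ p (shiftZ Q₀) (shiftZ P₀) (suc (k ℕ.+ m)))
                                  (trans (residual-shiftZ p Q₀ P₀ (k ℕ.+ m))
                                         (residualQP-above k m)))) ⟩
    α ^ suc k * fallingFactorial (+ suc m) (suc k) * p (suc m) + bTerm + cTerm
      ≡⟨ cong (λ t → α ^ suc k * t * p (suc m) + bTerm + cTerm) (fallingFactorial-suc (+ m) k) ⟩
    α ^ suc k * ((1ℤ + + m) * F) * p (suc m) + bTerm + cTerm
      ≡⟨ shape α R (+ m) (+ k) F (p m) (α ^ k) ⟩
    α ^ (2 ℕ.+ k) * fallingFactorial (+ m) (2 ℕ.+ k) * p m ∎
    where
    Q₁ = Q α R (suc k)
    P₁ = P α R (suc k)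
    Q₀ = Q α R k
    P₀ = P α R k
    F = fallingFactorial (+ m) k
    bTerm = b k * (α ^ suc k * fallingFactorial (+ m) (suc k) * p m)
    cTerm = c k * (α ^ k * F * p m)
    -- the closed form satisfies the three-term recurrence of P_h and Q_h
    shape : ∀ a r M K F x A →
      a * A * ((1ℤ + M) * F) * (x * (r + a * M))
      + (- (r + + 2 * a * (1ℤ + K))) * (a * A * (F * (M - K)) * x)
      + (- (a * (r + a * K) * (1ℤ + K))) * (A * F * x)
        ≡ a * (a * A) * (F * (M - K) * (M - (1ℤ + K))) * x
    shape = solve-∀

  residualQP-diagonal : ∀ k → residualQP (suc k) (suc k) ≡ 0ℤ
  residualQP-diagonal k = begin
    residualQP (suc k) (suc k)
      ≡⟨ cong (residualQP (suc k)) (sym (ℕP.+-identityʳ (suc k))) ⟩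
    residualQP (suc k) (suc k ℕ.+ 0)
      ≡⟨ residualQP-above (suc k) 0 ⟩
    α ^ suc k * fallingFactorial (+ 0) (suc k) * 1ℤ
      ≡⟨ cong (λ t → α ^ suc k * t * 1ℤ) (fallingFactorial-vanishes 0 (suc k) (s≤s z≤n)) ⟩
    α ^ suc k * 0ℤ * 1ℤ
      ≡⟨ cong (_* 1ℤ) (ℤP.*-zeroʳ (α ^ suc k)) ⟩
    0ℤ ∎

  residualQP-below : ∀ h → residualQP h VanishesBelow h
  residualQP-below zero          n       ()
  residualQP-below (suc zero)    zero    _ = refl
  residualQP-below (suc zero)    (suc n) (s≤s ())
  residualQP-below (suc (suc k)) n n<h =
    trans (residual-recStep k (Q α R (suc k)) (Q α R k) (P α R (suc k)) (P α R k) n)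
          (zeros (vanishesBelow-suc (residualQP-below (suc k)) (residualQP-diagonal k) n n<h)
                 (residual-shiftZ-vanishesBelow (residualQP-below (suc k)) n n<h)
                 (residual-shiftZ-vanishesBelow
                   (residual-shiftZ-vanishesBelow (residualQP-below k)) n n<h))
    where
    zeros : ∀ {x y z} → x ≡ 0ℤ → y ≡ 0ℤ → z ≡ 0ℤ → x + b k * y + c k * z ≡ 0ℤ
    zeros refl refl refl = shape (b k) (c k)
      where
      shape : ∀ u v → 0ℤ + u * 0ℤ + v * 0ℤ ≡ 0ℤ
      shape = solve-∀

  Λ : ℕ → ℤ
  Λ h = α ^ h * + (h !) * p h

  Λ-∣-residualQP : ∀ h n → Λ h ∣ₛ residualQP h n
  Λ-∣-residualQP h n with ℕP.<-≤-connex n h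
  ... | inj₁ n<h = ≡0⇒∣ (residualQP-below h n n<h)
  ... | inj₂ h≤n =
    subst (λ t → Λ h ∣ₛ residualQP h t) (ℕP.m+[n∸m]≡n h≤n) (at (n ℕ.∸ h))
    where
    at : ∀ m → Λ h ∣ₛ residualQP h (h ℕ.+ m)
    at m with ℕP.<-≤-connex m h
    ... | inj₁ m<h = ≡0⇒∣ (trans (residualQP-above h m)
      (trans (cong (λ t → α ^ h * t * p m) (fallingFactorial-vanishes m h m<h))
             (cong (_* p m) (ℤP.*-zeroʳ (α ^ h)))))
    ... | inj₂ h≤m = subst (_ ∣ₛ_) (sym (residualQP-above h m))
      (*-mono-∣ (*-monoʳ-∣ (α ^ h) (!∣fallingFactorial m h)) (pPoch-∣ h≤m))

  Λ-∣-convergentError : ∀ h n → Λ h ∣ₛ p n - convCoeff α R h n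
  Λ-∣-convergentError h with Q-constantTerm h
  ... | C , eq = ∣-seriesDivCoeff p (P α R h) C eq (Λ-∣-residualQP h)

open Convergents using (Λ-∣-convergentError)

mainTheorem2 : (α R : ℤ) → α ≢ + 0 → (h : ℕ) → 1 ≤ h → (n : ℕ) →
    ((N : ℤ) → N ∣ ((α ^ h) * (+ (h !)) * pPoch α R h) →
      N ∣ (pPoch α R n - convCoeff α R h n))
    × (2 ≤ h →
      ((+ h) ∣ (pPoch α R n - convCoeff α R h n))
      × ((i : ℕ) → 1 ≤ i → i ≤ h →
          ((+ h) * (α ^ i)) ∣ (pPoch α R n - convCoeff α R h n)))
mainTheorem2 α R _ h@(suc h-1) (s≤s _) n =
  viaΛ , λ _ → viaΛ (+ h) h∣Λ , λ i _ i≤h → viaΛ (+ h * α ^ i) (hαⁱ∣Λ i i≤h)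
  where
  viaΛ : (N : ℤ) → N ∣ (α ^ h * + (h !) * pPoch α R h) → N ∣ (pPoch α R n - convCoeff α R h n)
  viaΛ N N∣Λ = ∣⇒∣ᵤ (∣-trans (∣ᵤ⇒∣ {N} N∣Λ) (Λ-∣-convergentError α R h n))
  h∣h! : + h ∣ₛ + (h !)
  h∣h! = ∣ᵤ⇒∣ (ℕD.m∣m*n (h-1 !))
  h∣Λ : + h ∣ (α ^ h * + (h !) * pPoch α R h)
  h∣Λ = ∣⇒∣ᵤ (∣m⇒∣m*n (pPoch α R h) (∣n⇒∣m*n (α ^ h) h∣h!))
  hαⁱ∣Λ : ∀ i → i ≤ h → (+ h * α ^ i) ∣ (α ^ h * + (h !) * pPoch α R h)
  hαⁱ∣Λ i i≤h = ∣⇒∣ᵤ (∣m⇒∣m*n (pPoch α R h)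
    (subst (_∣ₛ (α ^ h * + (h !))) (ℤP.*-comm (α ^ i) (+ h))
      (*-mono-∣ (∣-mono-≤ (α ^_) (λ k → ∣n⇒∣m*n α ∣-refl) i≤h) h∣h!)))
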